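{- Let $n\ge0$ and let $(c_{i,j})$ be a non-zero frieze pattern of height $n$ over $\mathbb{R}$ such that every entry $c_{i,j}$ with $i+1\le j\le n+i+2$ lies in $\mathbb{R}_{>a}\cup\mathbb{R}_{<-a}$, where $a=\frac{1}{\sqrt2}$. For $i+1\le j\le n+i+2$ put $\varepsilon_{i,j}=1$ if $c_{i,j}>0$ and $\varepsilon_{i,j}=-1$ if $c_{i,j}<0$. Then: (a) for all $i\in\mathbb{Z}$ and $i+2\le j\le n+i+1$, $\varepsilon_{i,j}\varepsilon_{i+1,j}\varepsilon_{i,j+1}\varepsilon_{i+1,j+1}=1$; (b) for all $i\in\mathbb{Z}$ and $1\le\ell\le n+1$, $\varepsilon_{i,i+2}\varepsilon_{i+1,i+2}\varepsilon_{i,i+\ell+1}\varepsilon_{i+1,i+\ell+1}=1$; (c) the set $\{\varepsilon_{i,i+2}\mid i\in\mathbb{Z}\}$ has exactly one element.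
   Context: Let $R$ be a subset of a field. A non-zero frieze pattern of height $n\ge0$ over $R$ is a family $(c_{i,j})$, indexed by $i\in\mathbb{Z}$ and $i\le j\le n+i+3$, with $c_{i,i}=c_{i,n+i+3}=0$, $c_{i,i+1}=c_{i,n+i+2}=1$, $c_{i,j}\in R\setminus\{0\}$ for $i+2\le j\le n+i+1$, and $c_{i,j}c_{i+1,j+1}-c_{i,j+1}c_{i+1,j}=1$ for all $i\in\mathbb{Z}$ and $i+1\le j\le n+i+2$. -}

module Defs where

open import Level using (0ℓ)
open import Data.Nat using (ℕ)
open import Data.Integer as ℤ using (ℤ; +_; -[1+_])
open import Data.Product using (∃; _×_; _,_)
open import Data.Sum using (_⊎_)
open import Relation.Nullary using (¬_)
open import Relation.Binary using (Tri; tri<; tri≈; tri>)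
open import Relation.Binary.PropositionalEquality using (_≡_)
open import Relation.Binary.Structures using (IsStrictTotalOrder)
open import Algebra.Structures using (IsCommutativeRing)

-- Classically every such structure is isomorphic to ℝ, so quantifying
-- over all of them is the same as stating the result for ℝ.
record RealField : Set₁ where
  infixl 6 _+_
  infixl 7 _*_
  infix 4 _<_ _≤_
  field
    Carrier : Set
    _+_ _*_ : Carrier → Carrier → Carrier
    -_      : Carrier → Carrier
    0# 1#   : Carrier
    _<_     : Carrier → Carrier → Set
    isCommutativeRing : IsCommutativeRing _≡_ _+_ _*_ -_ 0# 1#
    0≢1     : ¬ (0# ≡ 1#)
    inverse : ∀ x → ¬ (x ≡ 0#) → ∃ λ y → x * y ≡ 1#
    isStrictTotalOrder : IsStrictTotalOrder _≡_ _<_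
    +-mono-< : ∀ {x y} z → x < y → x + z < y + z
    *-pos    : ∀ {x y} → 0# < x → 0# < y → 0# < x * y

  _≤_ : Carrier → Carrier → Set
  x ≤ y = x < y ⊎ x ≡ y

  field
    complete : (P : Carrier → Set) → ∃ P → (∃ λ b → ∀ x → P x → x ≤ b) →
               ∃ λ s → (∀ x → P x → x ≤ s) × (∀ b → (∀ x → P x → x ≤ b) → s ≤ b)

  open IsStrictTotalOrder isStrictTotalOrder public using (compare)

module _ (R : RealField) where
  open RealField R

  -- Non-zero frieze pattern of height n over R; c i j stands for c_{i,j}
  -- (values with j outside i ≤ j ≤ n+i+3 are irrelevant).
  record IsNonZeroFrieze (n : ℕ) (c : ℤ → ℤ → Carrier) : Set where
    field
      diag0  : ∀ i → c i i ≡ 0#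
      top0   : ∀ i → c i (i ℤ.+ + n ℤ.+ + 3) ≡ 0#
      diag1  : ∀ i → c i (i ℤ.+ + 1) ≡ 1#
      top1   : ∀ i → c i (i ℤ.+ + n ℤ.+ + 2) ≡ 1#
      nonzero : ∀ i j → i ℤ.+ + 2 ℤ.≤ j → j ℤ.≤ + n ℤ.+ i ℤ.+ + 1 → ¬ (c i j ≡ 0#)
      diamond : ∀ i j → i ℤ.+ + 1 ℤ.≤ j → j ℤ.≤ + n ℤ.+ i ℤ.+ + 2 →
                c i j * c (i ℤ.+ + 1) (j ℤ.+ + 1)
                  + - (c i (j ℤ.+ + 1) * c (i ℤ.+ + 1) j) ≡ 1#

  -- sign ε : 1 if x > 0, -1 if x < 0 (0 if x = 0, never used below)
  sgn : Carrier → ℤ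
  sgn x with compare 0# x
  ... | tri< _ _ _ = + 1
  ... | tri≈ _ _ _ = + 0
  ... | tri> _ _ _ = -[1+ 0 ]

-- The four entries of a diamond satisfy x w - z y = 1 and lie beyond ±a, so x w and
-- z y lie beyond ±a² = ±1/2; two such numbers differing by 1 have the same sign,
-- which is (a).  On two neighbouring rows, (a) says that the sign products of
-- consecutive vertical pairs agree, which gives (b); dually, the sign product of a
-- horizontal pair does not change down a column.  Combined with the glide relation
-- c_{k,k+n+1} = c_{k+n+1,k+n+3}, which follows from the row independence of
-- (c_{i,j-1} + c_{i,j+1}) / c_{i,j}, this gives ε_{i,i+2} = ε_{i+1,i+3}, hence (c).

module Submission where

open import Defs
open import Level using (0ℓ)
open import Data.Nat using (ℕ; zero; suc; z≤n; s≤s)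
import Data.Nat as ℕ
import Data.Nat.Properties as ℕP
open import Data.Integer as ℤ using (ℤ; +_; -[1+_]; ∣_∣)
import Data.Integer.Properties as ℤP
open import Data.Integer.Tactic.RingSolver using (solve-∀)
open import Data.Product using (∃; _×_; _,_; uncurry)
open import Data.Sum using (_⊎_; inj₁; inj₂)
open import Data.Empty using (⊥-elim)
open import Relation.Nullary using (¬_)
open import Relation.Binary using (tri<; tri≈; tri>)
open import Relation.Binary.PropositionalEquality
open import Relation.Binary.Structures using (IsStrictTotalOrder)
open import Algebra.Bundles using (CommutativeRing)
import Algebra.Properties.Ring as RingProperties
import Algebra.Properties.CommutativeSemigroup as CommutativeSemigroupProperties

-- i ⊕ r is i + r, defined so that i ⊕ suc r computes to (i ⊕ r) + 1:
-- neighbouring entries of a row are then neighbours definitionally.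
infixl 7 _⊕_
_⊕_ : ℤ → ℕ → ℤ
i ⊕ zero  = i
i ⊕ suc r = i ⊕ r ℤ.+ + 1

⊕-≡-+ : ∀ i r → i ⊕ r ≡ i ℤ.+ + r
⊕-≡-+ i zero    = sym (ℤP.+-identityʳ i)
⊕-≡-+ i (suc r) = begin
  i ⊕ r ℤ.+ + 1      ≡⟨ cong (ℤ._+ + 1) (⊕-≡-+ i r) ⟩
  i ℤ.+ + r ℤ.+ + 1  ≡⟨ ℤP.+-assoc i (+ r) (+ 1) ⟩
  i ℤ.+ + (r ℕ.+ 1)  ≡⟨ cong (λ s → i ℤ.+ + s) (ℕP.+-comm r 1) ⟩
  i ℤ.+ + suc r      ∎
  where open ≡-Reasoning

⊕-+ : ∀ i t r → i ⊕ (t ℕ.+ r) ≡ i ⊕ t ⊕ r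
⊕-+ i t zero    = cong (i ⊕_) (ℕP.+-identityʳ t)
⊕-+ i t (suc r) = trans (cong (i ⊕_) (ℕP.+-suc t r)) (cong (ℤ._+ + 1) (⊕-+ i t r))

+-cancelˡ-≤ : ∀ i {x y} → i ℤ.+ x ℤ.≤ i ℤ.+ y → x ℤ.≤ y
+-cancelˡ-≤ i {x} {y} h =
  subst₂ ℤ._≤_ (cancel i x) (cancel i y) (ℤP.+-monoʳ-≤ (ℤ.- i) h)
  where
  cancel : ∀ i x → ℤ.- i ℤ.+ (i ℤ.+ x) ≡ x
  cancel = solve-∀

⊕-mono-≤ : ∀ i {p r} → p ℕ.≤ r → i ⊕ p ℤ.≤ i ⊕ r
⊕-mono-≤ i {p} {r} p≤r =
  subst₂ ℤ._≤_ (sym (⊕-≡-+ i p)) (sym (⊕-≡-+ i r)) (ℤP.+-monoʳ-≤ i (ℤ.+≤+ p≤r))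

⊕-cancel-≤ : ∀ i {p r} → i ⊕ p ℤ.≤ i ⊕ r → p ℕ.≤ r
⊕-cancel-≤ i {p} {r} h =
  ℤP.drop‿+≤+ (+-cancelˡ-≤ i (subst₂ ℤ._≤_ (⊕-≡-+ i p) (⊕-≡-+ i r) h))

⊕-difference : ∀ {i j} → i ℤ.≤ j → j ≡ i ⊕ ∣ j ℤ.- i ∣
⊕-difference {i} {j} i≤j = begin
  j                      ≡⟨ split i j ⟩
  i ℤ.+ (j ℤ.- i)
    ≡⟨ cong (λ d → i ℤ.+ d) (sym (ℤP.0≤i⇒+∣i∣≡i (ℤP.i≤j⇒0≤j-i i≤j))) ⟩
  i ℤ.+ + ∣ j ℤ.- i ∣    ≡⟨ sym (⊕-≡-+ i _) ⟩
  i ⊕ ∣ j ℤ.- i ∣        ∎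
  where
  open ≡-Reasoning
  split : ∀ i j → j ≡ i ℤ.+ (j ℤ.- i)
  split = solve-∀

upper-≡ : ∀ n i q → + n ℤ.+ i ℤ.+ + q ≡ i ⊕ (q ℕ.+ n)
upper-≡ n i q = trans (reorder (+ n) i (+ q)) (sym (⊕-≡-+ i (q ℕ.+ n)))
  where
  reorder : ∀ N i Q → N ℤ.+ i ℤ.+ Q ≡ i ℤ.+ (Q ℤ.+ N)
  reorder = solve-∀

toStrip : ∀ n i {p q r} → p ℕ.≤ r → r ℕ.≤ q ℕ.+ n →
          i ℤ.+ + p ℤ.≤ i ⊕ r × i ⊕ r ℤ.≤ + n ℤ.+ i ℤ.+ + q
toStrip n i {p} {q} {r} p≤r r≤q+n =
  subst (ℤ._≤ i ⊕ r) (⊕-≡-+ i p) (⊕-mono-≤ i p≤r) ,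
  subst (i ⊕ r ℤ.≤_) (sym (upper-≡ n i q)) (⊕-mono-≤ i r≤q+n)

fromStrip : ∀ n i j {p q} → i ℤ.+ + p ℤ.≤ j → j ℤ.≤ + n ℤ.+ i ℤ.+ + q →
            ∃ λ r → j ≡ i ⊕ r × p ℕ.≤ r × r ℕ.≤ q ℕ.+ n
fromStrip n i j {p} {q} lo hi =
  ∣ j ℤ.- i ∣ ,
  j≡ ,
  ⊕-cancel-≤ i (subst₂ ℤ._≤_ (sym (⊕-≡-+ i p)) j≡ lo) ,
  ⊕-cancel-≤ i (subst₂ ℤ._≤_ j≡ (upper-≡ n i q) hi)
  where
  j≡ : j ≡ i ⊕ ∣ j ℤ.- i ∣
  j≡ = ⊕-difference (ℤP.≤-trans (ℤP.i≤i+j i (+ p)) lo)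

constant-by-steps : ∀ {A : Set} (g : ℤ → A) → (∀ i → g i ≡ g (i ℤ.+ + 1)) →
                    ∀ i → g i ≡ g (+ 0)
constant-by-steps g step (+ zero)      = refl
constant-by-steps g step (+ suc m)     =
  trans (sym (trans (step (+ m)) (cong (λ k → g (+ k)) (ℕP.+-comm m 1))))
        (constant-by-steps g step (+ m))
constant-by-steps g step -[1+ zero ]   = step -[1+ 0 ]
constant-by-steps g step -[1+ suc m ]  =
  trans (step -[1+ suc m ]) (constant-by-steps g step -[1+ m ])

∣i∣≡1⇒i≡±1 : ∀ i → ∣ i ∣ ≡ 1 → i ≡ + 1 ⊎ i ≡ -[1+ 0 ]
∣i∣≡1⇒i≡±1 (+ .1)    refl = inj₁ refl
∣i∣≡1⇒i≡±1 -[1+ .0 ] refl = inj₂ refl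

*≡1⇒≡ : ∀ x y → x ℤ.* y ≡ + 1 → x ≡ y
*≡1⇒≡ x y xy≡1
  with ∣i∣≡1⇒i≡±1 x (ℕP.m*n≡1⇒m≡1 ∣ x ∣ ∣ y ∣
                       (trans (sym (ℤP.abs-* x y)) (cong ∣_∣ xy≡1)))
... | inj₁ refl = sym (trans (sym (ℤP.*-identityˡ y)) xy≡1)
... | inj₂ refl =
  sym (trans (sym (ℤP.neg-involutive y)) (cong ℤ.-_ (trans (sym (ℤP.-1*i≡-i y)) xy≡1)))

-- s t r is the sign in row t, r steps to the right of the diagonal.
SignDiamonds : ℕ → (ℕ → ℕ → ℤ) → Set
SignDiamonds n s = ∀ t m → 1 ℕ.≤ m → m ℕ.≤ n →
  s t (suc m) ℤ.* s (suc t) m ℤ.* s t (2 ℕ.+ m) ℤ.* s (suc t) (suc m) ≡ + 1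

vertical : (ℕ → ℕ → ℤ) → ℕ → ℕ → ℤ
vertical s t m = s t (suc m) ℤ.* s (suc t) m

horizontal : (ℕ → ℕ → ℤ) → ℕ → ℕ → ℤ
horizontal s t m = s t (suc m) ℤ.* s t (2 ℕ.+ m)

*-exchange : ∀ x y z w → x ℤ.* y ℤ.* z ℤ.* w ≡ (x ℤ.* z) ℤ.* (y ℤ.* w)
*-exchange = solve-∀

module _ {n} {s : ℕ → ℕ → ℤ} (diamonds : SignDiamonds n s) where

  vertical-invariant : ∀ t m → 1 ℕ.≤ m → m ℕ.≤ 1 ℕ.+ n → vertical s t m ≡ vertical s t 1
  vertical-invariant t (suc zero)    _ _         = refl
  vertical-invariant t (suc (suc m)) _ (s≤s m<n) =
    trans (sym (*≡1⇒≡ _ _ (trans (sym (ℤP.*-assoc (vertical s t (suc m)) _ _))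
                                 (diamonds t (suc m) (s≤s z≤n) m<n))))
          (vertical-invariant t (suc m) (s≤s z≤n) (ℕP.m≤n⇒m≤1+n m<n))

  horizontal-invariant : ∀ u t → t ℕ.≤ n → horizontal s u t ≡ horizontal s (u ℕ.+ t) 0
  horizontal-invariant u zero    _   = cong (λ v → horizontal s v 0) (sym (ℕP.+-identityʳ u))
  horizontal-invariant u (suc t) t<n = begin
    horizontal s u (suc t)
      ≡⟨ *≡1⇒≡ _ _ (trans (sym (*-exchange (s u (2 ℕ.+ t)) _ _ _))
                          (diamonds u (suc t) (s≤s z≤n) t<n)) ⟩
    horizontal s (suc u) t
      ≡⟨ horizontal-invariant (suc u) t (ℕP.<⇒≤ t<n) ⟩
    horizontal s (suc u ℕ.+ t) 0
      ≡⟨ cong (λ v → horizontal s v 0) (sym (ℕP.+-suc u t)) ⟩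
    horizontal s (u ℕ.+ suc t) 0 ∎
    where open ≡-Reasoning

module OrderedField (R : RealField) where
  open RealField R
  open IsStrictTotalOrder isStrictTotalOrder using (irrefl; asym) renaming (trans to <-trans)

  commutativeRing : CommutativeRing 0ℓ 0ℓ
  commutativeRing = record { isCommutativeRing = isCommutativeRing }

  open CommutativeRing commutativeRing public
    using (_-_; +-comm; +-identityˡ; +-identityʳ; -‿inverseʳ; *-comm; *-identityˡ; *-identityʳ;
           distribˡ; distribʳ)
  open RingProperties (CommutativeRing.ring commutativeRing)
    using (-‿involutive; -0#≈0#; -‿distribˡ-*; -‿distribʳ-*; x[y-z]≈xy-xz;
           //-rightDividesˡ; x∙y⁻¹≈ε⇒x≈y)
  open CommutativeSemigroupProperties (CommutativeRing.*-commutativeSemigroup commutativeRing)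
    public using (xy∙z≈y∙xz; x∙yz≈yx∙z)
  module + = CommutativeSemigroupProperties (CommutativeRing.+-commutativeSemigroup commutativeRing)

  x<y⇒0<y-x : ∀ {x y} → x < y → 0# < y - x
  x<y⇒0<y-x {x} {y} h = subst (_< y - x) (-‿inverseʳ x) (+-mono-< (- x) h)

  0<y-x⇒x<y : ∀ {x y} → 0# < y - x → x < y
  0<y-x⇒x<y {x} {y} h = subst₂ _<_ (+-identityˡ x) (//-rightDividesˡ x y) (+-mono-< x h)

  neg-mono-< : ∀ {x y} → x < y → - y < - x
  neg-mono-< {x} {y} h =
    0<y-x⇒x<y (subst (0# <_) y-x≡-x--y (x<y⇒0<y-x h))
    where
    y-x≡-x--y : y - x ≡ - x - - y
    y-x≡-x--y = trans (+-comm y (- x)) (cong (λ v → - x + v) (sym (-‿involutive y)))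

  neg-flip : ∀ {x y} → x < - y → y < - x
  neg-flip {x} {y} h = subst (_< - x) (-‿involutive y) (neg-mono-< h)

  0<x⇒-x<0 : ∀ {x} → 0# < x → - x < 0#
  0<x⇒-x<0 {x} h = subst (- x <_) -0#≈0# (neg-mono-< h)

  x<0⇒0<-x : ∀ {x} → x < 0# → 0# < - x
  x<0⇒0<-x {x} h = subst (_< - x) -0#≈0# (neg-mono-< h)

  0<-x⇒x<0 : ∀ {x} → 0# < - x → x < 0#
  0<-x⇒x<0 {x} h = subst₂ _<_ (-‿involutive x) -0#≈0# (neg-mono-< h)

  +-mono₂-< : ∀ {x x′ y y′} → x < x′ → y < y′ → x + y < x′ + y′
  +-mono₂-< {x} {x′} {y} {y′} x<x′ y<y′ =
    <-trans (+-mono-< y x<x′) (subst₂ _<_ (+-comm y x′) (+-comm y′ x′) (+-mono-< x′ y<y′))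

  *-monoˡ-< : ∀ {x y z} → 0# < z → x < y → z * x < z * y
  *-monoˡ-< {x} {y} {z} 0<z x<y =
    0<y-x⇒x<y (subst (0# <_) (x[y-z]≈xy-xz z y x) (*-pos 0<z (x<y⇒0<y-x x<y)))

  *-mono-< : ∀ {b u v} → 0# < b → b < u → b < v → b * b < u * v
  *-mono-< {b} {u} {v} 0<b b<u b<v =
    <-trans (*-monoˡ-< 0<b b<v)
            (subst₂ _<_ (*-comm v b) (*-comm v u) (*-monoˡ-< (<-trans 0<b b<v) b<u))

  -x*-y≡x*y : ∀ x y → - x * - y ≡ x * y
  -x*-y≡x*y x y = trans (sym (-‿distribˡ-* x (- y)))
                        (trans (cong -_ (sym (-‿distribʳ-* x y))) (-‿involutive (x * y)))

  0<1 : 0# < 1#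
  0<1 with compare 0# 1#
  ... | tri< 0<1 _ _ = 0<1
  ... | tri≈ _ 0≡1 _ = ⊥-elim (0≢1 0≡1)
  ... | tri> _ _ 1<0 =
    ⊥-elim (asym 1<0 (subst (0# <_) (trans (-x*-y≡x*y 1# 1#) (*-identityʳ 1#))
                                     (*-pos (x<0⇒0<-x 1<0) (x<0⇒0<-x 1<0))))

  *-cancelˡ-≡ : ∀ {x y z} → ¬ z ≡ 0# → z * x ≡ z * y → x ≡ y
  *-cancelˡ-≡ {x} {y} {z} z≢0 zx≡zy with inverse z z≢0
  ... | z⁻¹ , zz⁻¹≡1 = begin
    x                ≡⟨ sym (*-identityˡ x) ⟩
    1# * x           ≡⟨ cong (_* x) (sym zz⁻¹≡1) ⟩
    z * z⁻¹ * x      ≡⟨ xy∙z≈y∙xz z z⁻¹ x ⟩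
    z⁻¹ * (z * x)    ≡⟨ cong (z⁻¹ *_) zx≡zy ⟩
    z⁻¹ * (z * y)    ≡⟨ sym (xy∙z≈y∙xz z z⁻¹ y) ⟩
    z * z⁻¹ * y      ≡⟨ cong (_* y) zz⁻¹≡1 ⟩
    1# * y           ≡⟨ *-identityˡ y ⟩
    y                ∎
    where open ≡-Reasoning

  x-y≡z⇒x≡z+y : ∀ {x y z} → x - y ≡ z → x ≡ z + y
  x-y≡z⇒x≡z+y {x} {y} x-y≡z = trans (sym (//-rightDividesˡ y x)) (cong (_+ y) x-y≡z)

  -- The determinant conditions of the two diamonds around C in rows i, i+1
  -- say that (c_{i,j-1} + c_{i,j+1}) / c_{i,j} does not depend on i.
  adjacent-diamonds : ∀ {A B C D E F} → A * B - C * D ≡ 1# → C * E - F * B ≡ 1# →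
                      (A + F) * B ≡ C * (D + E)
  adjacent-diamonds {A} {B} {C} {D} {E} {F} d₁ d₂ = begin
    (A + F) * B              ≡⟨ distribʳ B A F ⟩
    A * B + F * B            ≡⟨ cong (_+ F * B) (x-y≡z⇒x≡z+y d₁) ⟩
    1# + C * D + F * B       ≡⟨ +.xy∙z≈y∙xz 1# (C * D) (F * B) ⟩
    C * D + (1# + F * B)     ≡⟨ cong (λ v → C * D + v) (sym (x-y≡z⇒x≡z+y d₂)) ⟩
    C * D + C * E            ≡⟨ sym (distribˡ C D E) ⟩
    C * (D + E)              ∎
    where open ≡-Reasoning

  sgn-pos : ∀ {x} → 0# < x → sgn R x ≡ + 1
  sgn-pos {x} 0<x with compare 0# x
  ... | tri< _ _ _   = refl
  ... | tri≈ _ 0≡x _ = ⊥-elim (irrefl 0≡x 0<x)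
  ... | tri> _ _ x<0 = ⊥-elim (asym 0<x x<0)

  sgn-neg : ∀ {x} → x < 0# → sgn R x ≡ -[1+ 0 ]
  sgn-neg {x} x<0 with compare 0# x
  ... | tri< 0<x _ _ = ⊥-elim (asym 0<x x<0)
  ... | tri≈ _ 0≡x _ = ⊥-elim (irrefl (sym 0≡x) x<0)
  ... | tri> _ _ _   = refl

  x≢0⇒0<x∨x<0 : ∀ {x} → ¬ x ≡ 0# → 0# < x ⊎ x < 0#
  x≢0⇒0<x∨x<0 {x} x≢0 with compare 0# x
  ... | tri< 0<x _ _ = inj₁ 0<x
  ... | tri≈ _ 0≡x _ = ⊥-elim (x≢0 (sym 0≡x))
  ... | tri> _ _ x<0 = inj₂ x<0

  sgn-* : ∀ {x y} → ¬ x ≡ 0# → ¬ y ≡ 0# → sgn R (x * y) ≡ sgn R x ℤ.* sgn R y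
  sgn-* {x} {y} x≢0 y≢0 with x≢0⇒0<x∨x<0 x≢0 | x≢0⇒0<x∨x<0 y≢0
  ... | inj₁ 0<x | inj₁ 0<y rewrite sgn-pos 0<x | sgn-pos 0<y =
    sgn-pos (*-pos 0<x 0<y)
  ... | inj₁ 0<x | inj₂ y<0 rewrite sgn-pos 0<x | sgn-neg y<0 =
    sgn-neg (0<-x⇒x<0 (subst (0# <_) (sym (-‿distribʳ-* x y)) (*-pos 0<x (x<0⇒0<-x y<0))))
  ... | inj₂ x<0 | inj₁ 0<y rewrite sgn-neg x<0 | sgn-pos 0<y =
    sgn-neg (0<-x⇒x<0 (subst (0# <_) (sym (-‿distribˡ-* x y)) (*-pos (x<0⇒0<-x x<0) 0<y)))
  ... | inj₂ x<0 | inj₂ y<0 rewrite sgn-neg x<0 | sgn-neg y<0 =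
    sgn-pos (subst (0# <_) (-x*-y≡x*y x y) (*-pos (x<0⇒0<-x x<0) (x<0⇒0<-x y<0)))

  sgn*sgn≡1 : ∀ {x} → ¬ x ≡ 0# → sgn R x ℤ.* sgn R x ≡ + 1
  sgn*sgn≡1 x≢0 with x≢0⇒0<x∨x<0 x≢0
  ... | inj₁ 0<x rewrite sgn-pos 0<x = refl
  ... | inj₂ x<0 rewrite sgn-neg x<0 = refl

  Beyond : Carrier → Carrier → Set
  Beyond b v = b < v ⊎ v < - b

  beyond⇒≢0 : ∀ {b v} → 0# < b → Beyond b v → ¬ v ≡ 0#
  beyond⇒≢0 0<b (inj₁ b<v)  v≡0 = irrefl (sym v≡0) (<-trans 0<b b<v)
  beyond⇒≢0 0<b (inj₂ v<-b) v≡0 = irrefl v≡0 (<-trans v<-b (0<x⇒-x<0 0<b))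

  beyond-* : ∀ {b u v} → 0# < b → Beyond b u → Beyond b v → Beyond (b * b) (u * v)
  beyond-* 0<b (inj₁ b<u)  (inj₁ b<v)  = inj₁ (*-mono-< 0<b b<u b<v)
  beyond-* {b} {u} {v} 0<b (inj₂ u<-b) (inj₂ v<-b) =
    inj₁ (subst (b * b <_) (-x*-y≡x*y u v) (*-mono-< 0<b (neg-flip u<-b) (neg-flip v<-b)))
  beyond-* {b} {u} {v} 0<b (inj₁ b<u)  (inj₂ v<-b) =
    inj₂ (neg-flip (subst (b * b <_) (sym (-‿distribʳ-* u v)) (*-mono-< 0<b b<u (neg-flip v<-b))))
  beyond-* {b} {u} {v} 0<b (inj₂ u<-b) (inj₁ b<v)  =
    inj₂ (neg-flip (subst (b * b <_) (sym (-‿distribˡ-* u v)) (*-mono-< 0<b (neg-flip u<-b) b<v)))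

  beyond-sgn-≡ : ∀ {b p q} → 0# < b → b + b ≡ 1# → Beyond b p → Beyond b q → p - q ≡ 1# →
                 sgn R p ≡ sgn R q
  beyond-sgn-≡ 0<b _ (inj₁ b<p) (inj₁ b<q) _ =
    trans (sgn-pos (<-trans 0<b b<p)) (sym (sgn-pos (<-trans 0<b b<q)))
  beyond-sgn-≡ 0<b _ (inj₂ p<-b) (inj₂ q<-b) _ =
    trans (sgn-neg (<-trans p<-b (0<x⇒-x<0 0<b))) (sym (sgn-neg (<-trans q<-b (0<x⇒-x<0 0<b))))
  beyond-sgn-≡ 0<b b+b≡1 (inj₁ b<p) (inj₂ q<-b) p-q≡1 =
    ⊥-elim (irrefl refl (subst₂ _<_ b+b≡1 p-q≡1 (+-mono₂-< b<p (neg-flip q<-b))))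
  beyond-sgn-≡ 0<b _ (inj₂ p<-b) (inj₁ b<q) p-q≡1 =
    ⊥-elim (asym 0<1 (subst₂ _<_ p-q≡1 (+-identityʳ 0#)
      (+-mono₂-< (<-trans p<-b (0<x⇒-x<0 0<b)) (<-trans (neg-mono-< b<q) (0<x⇒-x<0 0<b)))))

  diamond-sgn : ∀ {a x y z w} → 0# < a → a * a + a * a ≡ 1# →
                Beyond a x → Beyond a y → Beyond a z → Beyond a w → x * w - z * y ≡ 1# →
                sgn R x ℤ.* sgn R y ℤ.* sgn R z ℤ.* sgn R w ≡ + 1
  diamond-sgn {a} {x} {y} {z} {w} 0<a 2a²≡1 bx by bz bw det≡1 = begin
    sgn R x ℤ.* sgn R y ℤ.* sgn R z ℤ.* sgn R w
      ≡⟨ regroup (sgn R x) (sgn R y) (sgn R z) (sgn R w) ⟩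
    (sgn R x ℤ.* sgn R w) ℤ.* (sgn R z ℤ.* sgn R y)
      ≡⟨ cong₂ ℤ._*_ (sym (sgn-* (≢0 bx) (≢0 bw))) (sym (sgn-* (≢0 bz) (≢0 by))) ⟩
    sgn R (x * w) ℤ.* sgn R (z * y)
      ≡⟨ cong (ℤ._* _) (beyond-sgn-≡ 0<a² 2a²≡1 (beyond-* 0<a bx bw)
                                                 (beyond-* 0<a bz by) det≡1) ⟩
    sgn R (z * y) ℤ.* sgn R (z * y)
      ≡⟨ sgn*sgn≡1 (beyond⇒≢0 0<a² (beyond-* 0<a bz by)) ⟩
    + 1 ∎
    where
    open ≡-Reasoning
    0<a² : 0# < a * a
    0<a² = *-pos 0<a 0<a
    ≢0 : ∀ {v} → Beyond a v → ¬ v ≡ 0#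
    ≢0 = beyond⇒≢0 0<a
    regroup : ∀ s t u v → s ℤ.* t ℤ.* u ℤ.* v ≡ (s ℤ.* v) ℤ.* (u ℤ.* t)
    regroup = solve-∀

module Frieze (R : RealField) where
  open RealField R
  open OrderedField R

  -- A frieze of height n in offset coordinates, read from some row on:
  -- f t r is the entry r steps right of the diagonal in the t-th row.
  record IsOffsetFrieze (n : ℕ) (f : ℕ → ℕ → Carrier) : Set where
    field
      diag0   : ∀ t → f t 0 ≡ 0#
      diag1   : ∀ t → f t 1 ≡ 1#
      top1    : ∀ t → f t (2 ℕ.+ n) ≡ 1#
      top0    : ∀ t → f t (3 ℕ.+ n) ≡ 0#
      nonzero : ∀ t r → 2 ℕ.≤ r → r ℕ.≤ 1 ℕ.+ n → ¬ f t r ≡ 0#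
      diamond : ∀ t m → m ℕ.≤ 1 ℕ.+ n →
                f t (suc m) * f (suc t) (suc m) - f t (2 ℕ.+ m) * f (suc t) m ≡ 1#

  module _ {n f} (F : IsOffsetFrieze n f) where
    open IsOffsetFrieze F

    private
      ≢0 : ∀ t m → m ℕ.≤ n → ¬ f t (2 ℕ.+ m) ≡ 0#
      ≢0 t m m≤n with ℕP.m≤n⇒m<n∨m≡n m≤n
      ... | inj₁ m<n  = nonzero t (2 ℕ.+ m) (s≤s (s≤s z≤n)) (s≤s m<n)
      ... | inj₂ refl = λ f≡0 → 0≢1 (trans (sym f≡0) (top1 t))

      Q₀ : Carrier
      Q₀ = f 0 (1 ℕ.+ n) + f 0 (3 ℕ.+ n)

    -- Walking down the column through f 0 (2 + n) = 1, the quotient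
    -- (left neighbour + right neighbour) / entry stays equal to Q₀.
    column-quotient : ∀ t m → t ℕ.+ m ≡ 1 ℕ.+ n → Q₀ * f t (suc m) ≡ f t m + f t (2 ℕ.+ m)
    column-quotient zero    .(suc n) refl = trans (cong (Q₀ *_) (top1 0)) (*-identityʳ Q₀)
    column-quotient (suc t) m        eq   = *-cancelˡ-≡ (≢0 t m m≤n) (begin
      f t (2 ℕ.+ m) * (Q₀ * f (suc t) (suc m))
        ≡⟨ x∙yz≈yx∙z (f t (2 ℕ.+ m)) Q₀ _ ⟩
      Q₀ * f t (2 ℕ.+ m) * f (suc t) (suc m)
        ≡⟨ cong (_* f (suc t) (suc m)) (column-quotient t (suc m) (trans (ℕP.+-suc t m) eq)) ⟩
      (f t (suc m) + f t (3 ℕ.+ m)) * f (suc t) (suc m)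
        ≡⟨ adjacent-diamonds (diamond t m (ℕP.m≤n⇒m≤1+n m≤n)) (diamond t (suc m) (s≤s m≤n)) ⟩
      f t (2 ℕ.+ m) * (f (suc t) m + f (suc t) (2 ℕ.+ m)) ∎)
      where
      open ≡-Reasoning
      m≤n : m ℕ.≤ n
      m≤n = subst (m ℕ.≤_) (ℕP.suc-injective eq) (ℕP.m≤n+m m t)

    glide : f 0 (1 ℕ.+ n) ≡ f (1 ℕ.+ n) 2
    glide = begin
      f 0 (1 ℕ.+ n)                  ≡⟨ sym (+-identityʳ _) ⟩
      f 0 (1 ℕ.+ n) + 0#             ≡⟨ cong (λ v → f 0 (1 ℕ.+ n) + v) (sym (top0 0)) ⟩
      Q₀                             ≡⟨ sym (*-identityʳ Q₀) ⟩
      Q₀ * 1#                        ≡⟨ cong (Q₀ *_) (sym (diag1 (1 ℕ.+ n))) ⟩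
      Q₀ * f (1 ℕ.+ n) 1             ≡⟨ column-quotient (1 ℕ.+ n) 0 (cong suc (ℕP.+-identityʳ n)) ⟩
      f (1 ℕ.+ n) 0 + f (1 ℕ.+ n) 2  ≡⟨ cong (_+ f (1 ℕ.+ n) 2) (diag0 (1 ℕ.+ n)) ⟩
      0# + f (1 ℕ.+ n) 2             ≡⟨ +-identityˡ _ ⟩
      f (1 ℕ.+ n) 2                  ∎
      where open ≡-Reasoning

  module Offsets {n c} (F : IsNonZeroFrieze R n c) where
    open IsNonZeroFrieze F

    offsets : ℤ → ℕ → ℕ → Carrier
    offsets k t r = c (k ⊕ t) (k ⊕ (t ℕ.+ r))

    inStrip : ∀ k t {r} p q → p ℕ.≤ r → r ℕ.≤ q ℕ.+ n →
              k ⊕ t ℤ.+ + p ℤ.≤ k ⊕ (t ℕ.+ r) × k ⊕ (t ℕ.+ r) ℤ.≤ + n ℤ.+ k ⊕ t ℤ.+ + q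
    inStrip k t {r} p q lo hi rewrite ⊕-+ k t r = toStrip n (k ⊕ t) lo hi

    offsetFrieze : ∀ k → IsOffsetFrieze n (offsets k)
    offsetFrieze k = record
      { diag0   = λ t → trans (cong (λ r → c (k ⊕ t) (k ⊕ r)) (ℕP.+-identityʳ t)) (diag0 (k ⊕ t))
      ; diag1   = λ t → trans (cong (λ r → c (k ⊕ t) (k ⊕ r)) (ℕP.+-comm t 1)) (diag1 (k ⊕ t))
      ; top1    = λ t → trans (cong (c (k ⊕ t)) (top-column t 2)) (top1 (k ⊕ t))
      ; top0    = λ t → trans (cong (c (k ⊕ t)) (top-column t 3)) (top0 (k ⊕ t))
      ; nonzero = λ t r lo hi → uncurry (nonzero (k ⊕ t) (k ⊕ (t ℕ.+ r))) (inStrip k t 2 1 lo hi)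
      ; diamond = diamond′
      }
      where
      top-column : ∀ t q → k ⊕ (t ℕ.+ (q ℕ.+ n)) ≡ k ⊕ t ℤ.+ + n ℤ.+ + q
      top-column t q = trans (⊕-+ k t (q ℕ.+ n))
                             (trans (⊕-≡-+ (k ⊕ t) (q ℕ.+ n)) (reorder (k ⊕ t) (+ n) (+ q)))
        where
        reorder : ∀ i N Q → i ℤ.+ (Q ℤ.+ N) ≡ i ℤ.+ N ℤ.+ Q
        reorder = solve-∀

      diamond′ : ∀ t m → m ℕ.≤ 1 ℕ.+ n →
                 offsets k t (suc m) * offsets k (suc t) (suc m)
                   - offsets k t (2 ℕ.+ m) * offsets k (suc t) m ≡ 1#
      diamond′ t m m≤1+n rewrite ℕP.+-suc t (suc m) | sym (cong (k ⊕_) (ℕP.+-suc t m)) =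
        uncurry (diamond (k ⊕ t) (k ⊕ (t ℕ.+ suc m)))
                (inStrip k t 1 2 (s≤s z≤n) (s≤s m≤1+n))

    module Signs {a} (0<a : 0# < a) (2a²≡1 : a * a + a * a ≡ 1#)
                 (beyond : ∀ i j → i ℤ.+ + 1 ℤ.≤ j → j ℤ.≤ + n ℤ.+ i ℤ.+ + 2 → Beyond a (c i j))
                 where

      signs : ℤ → ℕ → ℕ → ℤ
      signs k t r = sgn R (offsets k t r)

      beyond-offsets : ∀ k t r → 1 ℕ.≤ r → r ℕ.≤ 2 ℕ.+ n → Beyond a (offsets k t r)
      beyond-offsets k t r lo hi = uncurry (beyond (k ⊕ t) (k ⊕ (t ℕ.+ r))) (inStrip k t 1 2 lo hi)

      sign-diamonds : ∀ k → SignDiamonds n (signs k)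
      sign-diamonds k t m 1≤m m≤n =
        diamond-sgn 0<a 2a²≡1
          (beyond-offsets k t (suc m) (s≤s z≤n) (s≤s m≤1+n))
          (beyond-offsets k (suc t) m 1≤m (ℕP.m≤n⇒m≤1+n m≤1+n))
          (beyond-offsets k t (2 ℕ.+ m) (s≤s z≤n) (s≤s (s≤s m≤n)))
          (beyond-offsets k (suc t) (suc m) (s≤s z≤n) (s≤s m≤1+n))
          (IsOffsetFrieze.diamond (offsetFrieze k) t m m≤1+n)
        where
        m≤1+n : m ℕ.≤ 1 ℕ.+ n
        m≤1+n = ℕP.m≤n⇒m≤1+n m≤n

      signs-one : ∀ k t → signs k t 1 ≡ + 1
      signs-one k t = trans (cong (sgn R) (IsOffsetFrieze.diag1 (offsetFrieze k) t)) (sgn-pos 0<1)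

      signs-top : ∀ k t → signs k t (2 ℕ.+ n) ≡ + 1
      signs-top k t = trans (cong (sgn R) (IsOffsetFrieze.top1 (offsetFrieze k) t)) (sgn-pos 0<1)

      frieze-sign-diamonds : ∀ i j → i ℤ.+ + 2 ℤ.≤ j → j ℤ.≤ + n ℤ.+ i ℤ.+ + 1 →
        sgn R (c i j) ℤ.* sgn R (c (i ℤ.+ + 1) j) ℤ.* sgn R (c i (j ℤ.+ + 1))
          ℤ.* sgn R (c (i ℤ.+ + 1) (j ℤ.+ + 1)) ≡ + 1
      frieze-sign-diamonds i j lo hi with fromStrip n i j lo hi
      ... | suc m , refl , s≤s 1≤m , s≤s m≤n = sign-diamonds i 0 m 1≤m m≤n

      frieze-sign-pairs : ∀ i (ℓ : ℕ) → 1 ℕ.≤ ℓ → ℓ ℕ.≤ n ℕ.+ 1 →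
        sgn R (c i (i ℤ.+ + 2)) ℤ.* sgn R (c (i ℤ.+ + 1) (i ℤ.+ + 2))
          ℤ.* sgn R (c i (i ℤ.+ + ℓ ℤ.+ + 1))
          ℤ.* sgn R (c (i ℤ.+ + 1) (i ℤ.+ + ℓ ℤ.+ + 1)) ≡ + 1
      frieze-sign-pairs i ℓ 1≤ℓ ℓ≤n+1 rewrite sym (⊕-≡-+ i 2) | sym (⊕-≡-+ i ℓ) = begin
        vertical s 0 1 ℤ.* s 0 (suc ℓ) ℤ.* s 1 ℓ
          ≡⟨ ℤP.*-assoc (vertical s 0 1) (s 0 (suc ℓ)) (s 1 ℓ) ⟩
        vertical s 0 1 ℤ.* vertical s 0 ℓ
          ≡⟨ cong (vertical s 0 1 ℤ.*_)
                  (vertical-invariant {s = s} (sign-diamonds i) 0 ℓ 1≤ℓ ℓ≤1+n) ⟩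
        vertical s 0 1 ℤ.* vertical s 0 1
          ≡⟨ cong₂ ℤ._*_ first first ⟩
        s 0 2 ℤ.* s 0 2
          ≡⟨ sgn*sgn≡1 (beyond⇒≢0 0<a (beyond-offsets i 0 2 (s≤s z≤n) (s≤s (s≤s z≤n)))) ⟩
        + 1 ∎
        where
        open ≡-Reasoning
        s : ℕ → ℕ → ℤ
        s = signs i
        ℓ≤1+n : ℓ ℕ.≤ 1 ℕ.+ n
        ℓ≤1+n = subst (ℓ ℕ.≤_) (ℕP.+-comm n 1) ℓ≤n+1
        first : vertical s 0 1 ≡ s 0 2
        first = trans (cong (s 0 2 ℤ.*_) (signs-one i 1)) (ℤP.*-identityʳ (s 0 2))

      ε : ℤ → ℤ
      ε i = sgn R (c i (i ℤ.+ + 2))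

      signs-two : ∀ k t → signs k t 2 ≡ ε (k ⊕ t)
      signs-two k t = cong (λ j → sgn R (c (k ⊕ t) j)) (trans (⊕-+ k t 2) (⊕-≡-+ (k ⊕ t) 2))

      ε-step : ∀ k → ε (k ⊕ n) ≡ ε (k ⊕ suc n)
      ε-step k = begin
        ε (k ⊕ n)                          ≡⟨ sym (signs-two k n) ⟩
        s n 2                              ≡⟨ sym (ℤP.*-identityˡ (s n 2)) ⟩
        + 1 ℤ.* s n 2                      ≡⟨ cong (ℤ._* s n 2) (sym (signs-one k n)) ⟩
        horizontal s n 0
          ≡⟨ sym (horizontal-invariant {s = s} (sign-diamonds k) 0 n ℕP.≤-refl) ⟩
        horizontal s 0 n                   ≡⟨ cong (s 0 (suc n) ℤ.*_) (signs-top k 0) ⟩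
        s 0 (suc n) ℤ.* + 1                ≡⟨ ℤP.*-identityʳ (s 0 (suc n)) ⟩
        s 0 (suc n)                        ≡⟨ cong (sgn R) (glide (offsetFrieze k)) ⟩
        s (suc n) 2                        ≡⟨ signs-two k (suc n) ⟩
        ε (k ⊕ suc n)                      ∎
        where
        open ≡-Reasoning
        s : ℕ → ℕ → ℤ
        s = signs k

      ε-constant : ∀ i → ε i ≡ ε (+ 0)
      ε-constant = constant-by-steps ε λ i →
        subst (λ j → ε j ≡ ε (j ℤ.+ + 1)) (back i) (ε-step (i ℤ.- + n))
        where
        back : ∀ i → (i ℤ.- + n) ⊕ n ≡ i
        back i = trans (⊕-≡-+ (i ℤ.- + n) n) (cancel i (+ n))
          where
          cancel : ∀ i N → i ℤ.- N ℤ.+ N ≡ i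
          cancel = solve-∀

lemma4p1 : (R : RealField) → let open RealField R in
    (n : ℕ) (c : ℤ → ℤ → Carrier) → IsNonZeroFrieze R n c →
    (a : Carrier) → 0# < a → a * a + a * a ≡ 1# →
    (∀ i j → i ℤ.+ + 1 ℤ.≤ j → j ℤ.≤ + n ℤ.+ i ℤ.+ + 2 →
      (a < c i j) ⊎ (c i j < - a)) →
    (∀ i j → i ℤ.+ + 2 ℤ.≤ j → j ℤ.≤ + n ℤ.+ i ℤ.+ + 1 →
      sgn R (c i j) ℤ.* sgn R (c (i ℤ.+ + 1) j) ℤ.* sgn R (c i (j ℤ.+ + 1))
        ℤ.* sgn R (c (i ℤ.+ + 1) (j ℤ.+ + 1)) ≡ + 1)
    × (∀ i (ℓ : ℕ) → 1 Data.Nat.≤ ℓ → ℓ Data.Nat.≤ n Data.Nat.+ 1 →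
      sgn R (c i (i ℤ.+ + 2)) ℤ.* sgn R (c (i ℤ.+ + 1) (i ℤ.+ + 2))
        ℤ.* sgn R (c i (i ℤ.+ + ℓ ℤ.+ + 1))
        ℤ.* sgn R (c (i ℤ.+ + 1) (i ℤ.+ + ℓ ℤ.+ + 1)) ≡ + 1)
    × (∃ λ e → ∀ i → sgn R (c i (i ℤ.+ + 2)) ≡ e)
lemma4p1 R n c F a 0<a 2a²≡1 beyond =
  frieze-sign-diamonds , frieze-sign-pairs , ε (+ 0) , ε-constant
  where open Frieze.Offsets.Signs R F 0<a 2a²≡1 beyond
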